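{- Let $G=(V,E)$ be a connected graph and let $M$ be a module of $G$ with $\emptyset\ne M\ne V$. Let $C$, $F$, $O$, $R$ be a minimum vertex cover, a minimum feedback vertex set, a minimum odd cycle transversal, and a minimum connected vertex cover of $G$, respectively. Then: (1) $M\cap C$ is either $M$ or a minimum vertex cover of $G[M]$; (2) $M\cap F$ is either $M$, or $M\setminus\{v\}$ for some $v\in M$, or a minimum vertex cover of $G[M]$, or a minimum feedback vertex set of $G[M]$; (3) $M\cap O$ is either $M$, a minimum vertex cover of $G[M]$, or a minimum odd cycle transversal of $G[M]$; (4) $M\cap R$ is either $M$, a minimum vertex cover of $G[M]$, or $\{v\}$ for some $v\in M$.
   Context: A module of $G$ is a set $M\subseteq V$ such that every $v\in V\setminus M$ is adjacent to all or to none of $M$. A vertex cover is $X\subseteq V$ meeting every edge; a connected vertex cover is a vertex cover $X$ with $G[X]$ connected; a feedback vertex set is $X$ with $G-X$ a forest; an odd cycle transversal is $X$ with $G-X$ bipartite. Minimum means of minimum cardinality. -}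

module Defs where

open import Data.Nat using (ℕ; zero; suc; _≤_; _+_)
open import Data.Nat.Properties using ()
open import Data.Bool using (Bool; true; false)
open import Data.Fin using (Fin; zero; suc; inject₁; fromℕ)
open import Data.Fin.Subset using (Subset; _∈_; _∉_; _⊆_; ⊤; ∣_∣; _─_)
open import Data.Product using (Σ; ∃; _×_; _,_)
open import Data.Sum using (_⊎_)
open import Data.Empty using (⊥)
open import Relation.Nullary using (¬_)
open import Relation.Binary.PropositionalEquality using (_≡_; _≢_)
open import Function.Definitions using (Injective)

record Graph (n : ℕ) : Set where
  field
    adj    : Fin n → Fin n → Bool
    sym    : ∀ u v → adj u v ≡ adj v u
    irrefl : ∀ v → adj v v ≡ false

open Graph public

Adj : ∀ {n} → Graph n → Fin n → Fin n → Set
Adj G u v = adj G u v ≡ true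

data Walk {n} (G : Graph n) (S : Subset n) : Fin n → Fin n → Set where
  here : ∀ {u} → u ∈ S → Walk G S u u
  step : ∀ {u w v} → u ∈ S → Adj G u w → Walk G S w v → Walk G S u v

ConnectedIn : ∀ {n} → Graph n → Subset n → Set
ConnectedIn G S = ∀ u v → u ∈ S → v ∈ S → Walk G S u v

Connected : ∀ {n} → Graph n → Set
Connected G = ConnectedIn G ⊤

IsModule : ∀ {n} → Graph n → Subset n → Set
IsModule G M = ∀ v → v ∉ M →
  (∀ u → u ∈ M → Adj G v u) ⊎ (∀ u → u ∈ M → ¬ Adj G v u)

-- A cycle of G[T]: distinct vertices f 0, ..., f (k+2) (length k+3 ≥ 3),
-- all in T, consecutive ones adjacent and f (k+2) adjacent to f 0.
record Cycle {n} (G : Graph n) (T : Subset n) : Set where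
  field
    k      : ℕ
    f      : Fin (suc (suc (suc k))) → Fin n
    inj    : Injective _≡_ _≡_ f
    inT    : ∀ i → f i ∈ T
    edges  : ∀ (i : Fin (suc (suc k))) → Adj G (f (inject₁ i)) (f (suc i))
    close  : Adj G (f (fromℕ (suc (suc k)))) (f zero)

cycleLength : ∀ {n} {G : Graph n} {T : Subset n} → Cycle G T → ℕ
cycleLength c = suc (suc (suc (Cycle.k c)))

IsForest : ∀ {n} → Graph n → Subset n → Set
IsForest G T = ¬ Cycle G T

IsBipartite : ∀ {n} → Graph n → Subset n → Set
IsBipartite G T = Σ (Fin _ → Bool) λ c →
  ∀ u v → u ∈ T → v ∈ T → Adj G u v → c u ≢ c v

IsVC : ∀ {n} → Graph n → Subset n → Subset n → Set
IsVC G S X = X ⊆ S × (∀ u v → u ∈ S → v ∈ S → Adj G u v → u ∈ X ⊎ v ∈ X)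

IsCVC : ∀ {n} → Graph n → Subset n → Subset n → Set
IsCVC G S X = IsVC G S X × ConnectedIn G X

IsFVS : ∀ {n} → Graph n → Subset n → Subset n → Set
IsFVS G S X = X ⊆ S × IsForest G (S ─ X)

IsOCT : ∀ {n} → Graph n → Subset n → Subset n → Set
IsOCT G S X = X ⊆ S × IsBipartite G (S ─ X)

IsMinimum : ∀ {n} → (Subset n → Set) → Subset n → Set
IsMinimum P X = P X × (∀ Y → P Y → ∣ X ∣ ≤ ∣ Y ∣)

-- Let N be the set of vertices outside M adjacent to all of M; by the module property every
-- vertex outside M with a neighbour in M lies in N. Replacing the part inside M of a
-- solution X of G by a solution Y of G[M] changes its size by |M ∩ Y| − |M ∩ X|, so if the
-- result is again a solution and X is minimum, then |M ∩ X| ≤ |Y|.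
-- If X ⊇ N, no edge of G − X leaves M, so for the first three problems M ∩ X is a minimum
-- solution of G[M]. If X misses some u ∈ N, a (connected) vertex cover contains M, while for
-- the two transversal problems an edge of G[M] avoiding X would close a triangle with u, so
-- M ∩ X is a vertex cover of G[M]; it is a minimum one since patching with any vertex cover
-- of G[M] is still a solution: for feedback vertex sets when u is the only vertex of N
-- outside F (a cycle meeting M would have to enter and leave M through u), for odd cycle
-- transversals by colouring all of M like one vertex of M − O. Two vertices of N outside F
-- leave at most one vertex of M outside F, else they span a 4-cycle. A connected vertex
-- cover R ⊇ N stays connected after patching with a nonempty vertex cover of G[M], through
-- a vertex of N that exists because G is connected; when G[M] has no edges, patching with a
-- single vertex gives |M ∩ R| ≤ 1.

module Submission where

open import Defs hiding (sym)
open import Data.Nat as ℕ using (ℕ; _+_; _≤_; z≤n; s≤s)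
open import Data.Nat.Properties using (+-suc; +-cancelˡ-≤; +-monoˡ-≤; ≤-trans)
open import Data.Bool using (true; false; if_then_else_)
open import Data.Bool.Properties as Bool using (¬-not)
open import Data.Fin using (Fin; zero; suc; inject₁; fromℕ; _≟_)
open import Data.Fin.Induction using (<-weakInduction)
open import Data.Fin.Properties using (any?; all?; ¬∀⟶∃¬; suc-injective)
open import Data.Fin.Relation.Unary.Top using (view; ‵fromℕ; ‵inject₁)
open import Data.Fin.Subset
  using (Subset; _∈_; _∉_; _⊆_; _∩_; _─_; _-_; ⊤; ⁅_⁆; Nonempty; ∣_∣)
open import Data.Fin.Subset.Properties
  using ( _∈?_; ∈⊤; ⊆⊤; ⊆-antisym; drop-there; x∈p∩q⁺; x∈p∩q⁻; p∩q⊆p; ∣p∩q∣≤∣q∣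
        ; x∈p∧x∉q⇒x∈p─q; p─q⊆p; x∈p∧x≢y⇒x∈p-y; x∈p⇒∣p-x∣<∣p∣; p⊆q⇒∣p∣≤∣q∣
        ; x∈⁅x⁆; x∈⁅y⁆⇒x≡y; x∉⁅y⁆⇒x≢y; ∣⁅x⁆∣≡1; nonempty?; Empty-unique; ∣⊥∣≡0)
open import Data.Vec using ([]; _∷_; lookup; here; there)
open import Data.Vec.Relation.Unary.All using ([]; _∷_)
open import Data.Vec.Relation.Unary.All.Properties using (lookup⁺)
open import Data.Vec.Relation.Unary.AllPairs using ([]; _∷_)
open import Data.Vec.Relation.Unary.Unique.Propositional.Properties using (lookup-injective)
open import Data.Product using (_×_; ∃; ∃₂; _,_; proj₁; proj₂)
open import Data.Sum using (_⊎_; inj₁; inj₂; [_,_]; [_,_]′)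
import Data.Sum as Sum
open import Data.Empty using (⊥; ⊥-elim)
open import Function using (_∘_; id)
open import Relation.Nullary using (¬_; yes; no; Dec; contradiction)
open import Relation.Nullary.Decidable using (_×-dec_; _→-dec_; ¬?; decidable-stable)
open import Relation.Unary using (Pred; Decidable)
open import Relation.Binary.PropositionalEquality
  using (_≡_; _≢_; refl; sym; trans; cong; subst; ≢-sym)

private variable
  n : ℕ
  p q M X Y : Subset n
  C F O R : Subset n
  a b c d u v w x : Fin n

∀⊎∃¬ : ∀ {ℓ} {P Q : Pred (Fin n) ℓ} → Decidable P → Decidable Q →
       (∀ x → P x → Q x) ⊎ ∃ λ x → P x × ¬ Q x
∀⊎∃¬ P? Q? with any? (λ x → P? x ×-dec ¬? (Q? x))
... | yes (x , Px , ¬Qx) = inj₂ (x , Px , ¬Qx)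
... | no ∄ = inj₁ λ x Px → decidable-stable (Q? x) (λ ¬Qx → ∄ (x , Px , ¬Qx))

⊆⊎∃∉ : ∀ (p q : Subset n) → p ⊆ q ⊎ ∃ λ x → x ∈ p × x ∉ q
⊆⊎∃∉ p q = Sum.map₁ (λ p⊆q {x} → p⊆q x) (∀⊎∃¬ (_∈? p) (_∈? q))

x∈p─q⇒x∉q : ∀ (p q : Subset n) → x ∈ p ─ q → x ∉ q
x∈p─q⇒x∉q (_ ∷ p) (true  ∷ q) (there x∈p─q) = x∈p─q⇒x∉q p q x∈p─q ∘ drop-there
x∈p─q⇒x∉q (_ ∷ p) (false ∷ q) here          = λ ()
x∈p─q⇒x∉q (_ ∷ p) (false ∷ q) (there x∈p─q) = x∈p─q⇒x∉q p q x∈p─q ∘ drop-there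

x∉p⇒x∈⊤─p : x ∉ p → x ∈ ⊤ ─ p
x∉p⇒x∈⊤─p = x∈p∧x∉q⇒x∈p─q ∈⊤

p─p∩q⊆⊤─q : ∀ (p q : Subset n) → p ─ (p ∩ q) ⊆ ⊤ ─ q
p─p∩q⊆⊤─q p q x∈ = x∉p⇒x∈⊤─p λ x∈q →
  x∈p─q⇒x∉q p (p ∩ q) x∈ (x∈p∩q⁺ (p─q⊆p p (p ∩ q) x∈ , x∈q))

p⊆q⇒p∩q≡p : p ⊆ q → p ∩ q ≡ p
p⊆q⇒p∩q≡p {p = p} {q} p⊆q = ⊆-antisym (p∩q⊆p p q) (λ x∈p → x∈p∩q⁺ (x∈p , p⊆q x∈p))

x∈p∧∣p∣≤1⇒p≡⁅x⁆ : x ∈ p → ∣ p ∣ ≤ 1 → p ≡ ⁅ x ⁆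
x∈p∧∣p∣≤1⇒p≡⁅x⁆ {x = x} {p = p} x∈p ∣p∣≤1 = ⊆-antisym p⊆⁅x⁆ ⁅x⁆⊆p
  where
  ⁅x⁆⊆p : ⁅ x ⁆ ⊆ p
  ⁅x⁆⊆p y∈⁅x⁆ rewrite x∈⁅y⁆⇒x≡y x y∈⁅x⁆ = x∈p
  p⊆⁅x⁆ : p ⊆ ⁅ x ⁆
  p⊆⁅x⁆ {y} y∈p with y ≟ x
  ... | yes refl = x∈⁅x⁆ x
  ... | no y≢x with ≤-trans (x∈p⇒∣p-x∣<∣p∣ y∈p) ∣p∣≤1
  ...   | s≤s ∣p-y∣≤0 = contradiction (≤-trans 1≤∣p-y∣ ∣p-y∣≤0) λ ()
    where
    1≤∣p-y∣ : 1 ≤ ∣ p - y ∣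
    1≤∣p-y∣ = subst (_≤ ∣ p - y ∣) (∣⁅x⁆∣≡1 x)
      (p⊆q⇒∣p∣≤∣q∣ λ z∈⁅x⁆ → subst (_∈ p - y) (sym (x∈⁅y⁆⇒x≡y x z∈⁅x⁆))
                                  (x∈p∧x≢y⇒x∈p-y x∈p (≢-sym y≢x)))

-- Patching a solution inside M

patch : Subset n → Subset n → Subset n → Subset n
patch []      []      []      = []
patch (m ∷ M) (x ∷ X) (y ∷ Y) = (if m then y else x) ∷ patch M X Y

∈-patch-inside : x ∈ M → x ∈ Y → x ∈ patch M X Y
∈-patch-inside {X = _ ∷ _} here       here       = here
∈-patch-inside {X = _ ∷ _} (there x∈M) (there x∈Y) = there (∈-patch-inside x∈M x∈Y)

∈-patch-outside : x ∉ M → x ∈ X → x ∈ patch M X Y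
∈-patch-outside {M = true  ∷ _} {Y = _ ∷ _} x∉M here = contradiction here x∉M
∈-patch-outside {M = false ∷ _} {Y = _ ∷ _} x∉M here = here
∈-patch-outside {M = _ ∷ _} {Y = _ ∷ _} x∉M (there x∈X) =
  there (∈-patch-outside (x∉M ∘ there) x∈X)

∈-patch-outside⁻ : x ∉ M → x ∈ patch M X Y → x ∈ X
∈-patch-outside⁻ {M = true  ∷ _} {X = _ ∷ _} {Y = _ ∷ _} x∉M here = contradiction here x∉M
∈-patch-outside⁻ {M = false ∷ _} {X = _ ∷ _} {Y = _ ∷ _} x∉M here = here
∈-patch-outside⁻ {M = _ ∷ _} {X = _ ∷ _} {Y = _ ∷ _} x∉M (there x∈P) =
  there (∈-patch-outside⁻ (x∉M ∘ there) x∈P)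

⊤─patch-inside : x ∈ M → x ∈ ⊤ ─ patch M X Y → x ∈ M ─ Y
⊤─patch-inside {M = M} {X = X} {Y = Y} x∈M x∉P =
  x∈p∧x∉q⇒x∈p─q x∈M (x∈p─q⇒x∉q ⊤ (patch M X Y) x∉P ∘ ∈-patch-inside x∈M)

⊤─patch-outside : x ∉ M → x ∈ ⊤ ─ patch M X Y → x ∈ ⊤ ─ X
⊤─patch-outside {M = M} {X = X} {Y = Y} x∉M x∉P =
  x∉p⇒x∈⊤─p (x∈p─q⇒x∉q ⊤ (patch M X Y) x∉P ∘ ∈-patch-outside x∉M)

∣patch∣+∣M∩X∣≡∣X∣+∣M∩Y∣ : ∀ (M X Y : Subset n) →
  ∣ patch M X Y ∣ + ∣ M ∩ X ∣ ≡ ∣ X ∣ + ∣ M ∩ Y ∣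
∣patch∣+∣M∩X∣≡∣X∣+∣M∩Y∣ [] [] [] = refl
∣patch∣+∣M∩X∣≡∣X∣+∣M∩Y∣ (true ∷ M) (true ∷ X) (true ∷ Y)
  rewrite +-suc ∣ patch M X Y ∣ ∣ M ∩ X ∣ | +-suc ∣ X ∣ ∣ M ∩ Y ∣ =
  cong (ℕ.suc ∘ ℕ.suc) (∣patch∣+∣M∩X∣≡∣X∣+∣M∩Y∣ M X Y)
∣patch∣+∣M∩X∣≡∣X∣+∣M∩Y∣ (true ∷ M) (true ∷ X) (false ∷ Y)
  rewrite +-suc ∣ patch M X Y ∣ ∣ M ∩ X ∣ = cong ℕ.suc (∣patch∣+∣M∩X∣≡∣X∣+∣M∩Y∣ M X Y)
∣patch∣+∣M∩X∣≡∣X∣+∣M∩Y∣ (true ∷ M) (false ∷ X) (true ∷ Y)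
  rewrite +-suc ∣ X ∣ ∣ M ∩ Y ∣ = cong ℕ.suc (∣patch∣+∣M∩X∣≡∣X∣+∣M∩Y∣ M X Y)
∣patch∣+∣M∩X∣≡∣X∣+∣M∩Y∣ (true ∷ M) (false ∷ X) (false ∷ Y) = ∣patch∣+∣M∩X∣≡∣X∣+∣M∩Y∣ M X Y
∣patch∣+∣M∩X∣≡∣X∣+∣M∩Y∣ (false ∷ M) (true ∷ X) (_ ∷ Y) = cong ℕ.suc (∣patch∣+∣M∩X∣≡∣X∣+∣M∩Y∣ M X Y)
∣patch∣+∣M∩X∣≡∣X∣+∣M∩Y∣ (false ∷ M) (false ∷ X) (_ ∷ Y) = ∣patch∣+∣M∩X∣≡∣X∣+∣M∩Y∣ M X Y

patch-minimal : ∀ {P : Subset n → Set} → IsMinimum P X → P (patch M X Y) → ∣ M ∩ X ∣ ≤ ∣ Y ∣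
patch-minimal {X = X} {M = M} {Y = Y} (_ , X-min) P-patch =
  ≤-trans (+-cancelˡ-≤ ∣ X ∣ _ _ ∣X∣+∣M∩X∣≤∣X∣+∣M∩Y∣) (∣p∩q∣≤∣q∣ M Y)
  where
  ∣X∣+∣M∩X∣≤∣X∣+∣M∩Y∣ : ∣ X ∣ + ∣ M ∩ X ∣ ≤ ∣ X ∣ + ∣ M ∩ Y ∣
  ∣X∣+∣M∩X∣≤∣X∣+∣M∩Y∣ = subst (∣ X ∣ + ∣ M ∩ X ∣ ≤_) (∣patch∣+∣M∩X∣≡∣X∣+∣M∩Y∣ M X Y)
    (+-monoˡ-≤ ∣ M ∩ X ∣ (X-min _ P-patch))

-- Adjacency, cycles and walks

module _ (G : Graph n) where

  Adj-sym : Adj G u v → Adj G v u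
  Adj-sym {u = u} {v} uv = trans (Graph.sym G v u) uv

  Adj⇒≢ : Adj G u v → u ≢ v
  Adj⇒≢ {u = u} uu refl with trans (sym uu) (irrefl G u)
  ... | ()

  Adj? : ∀ u v → Dec (Adj G u v)
  Adj? u v = adj G u v Bool.≟ true

  module _ {T : Subset n} where

    cycle-within : ∀ {T′} (C : Cycle G T) → (∀ i → Cycle.f C i ∈ T′) → Cycle G T′
    cycle-within C inT′ = record { Cycle C; inT = inT′ }

    triangle : a ∈ T → b ∈ T → c ∈ T → Adj G a b → Adj G b c → Adj G c a → Cycle G T
    triangle {a = a} {b} {c} a∈T b∈T c∈T ab bc ca = record
      { k     = 0
      ; f     = lookup (a ∷ b ∷ c ∷ [])
      ; inj   = λ {i} {j} → lookup-injective distinct i j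
      ; inT   = lookup⁺ {P = _∈ T} (a∈T ∷ b∈T ∷ c∈T ∷ [])
      ; edges = λ { zero → ab ; (suc zero) → bc }
      ; close = ca
      }
      where
      distinct = (Adj⇒≢ ab ∷ ≢-sym (Adj⇒≢ ca) ∷ []) ∷ (Adj⇒≢ bc ∷ []) ∷ [] ∷ []

    square : a ≢ c → b ≢ d → a ∈ T → b ∈ T → c ∈ T → d ∈ T →
             Adj G a b → Adj G b c → Adj G c d → Adj G d a → Cycle G T
    square {a = a} {c} {b} {d} a≢c b≢d a∈T b∈T c∈T d∈T ab bc cd da = record
      { k     = 1
      ; f     = lookup (a ∷ b ∷ c ∷ d ∷ [])
      ; inj   = λ {i} {j} → lookup-injective distinct i j
      ; inT   = lookup⁺ {P = _∈ T} (a∈T ∷ b∈T ∷ c∈T ∷ d∈T ∷ [])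
      ; edges = λ { zero → ab ; (suc zero) → bc ; (suc (suc zero)) → cd }
      ; close = da
      }
      where
      distinct = (Adj⇒≢ ab ∷ a≢c ∷ ≢-sym (Adj⇒≢ da) ∷ [])
               ∷ (Adj⇒≢ bc ∷ b≢d ∷ []) ∷ (Adj⇒≢ cd ∷ []) ∷ [] ∷ []

    cycle-all : ∀ {ℓ} (P : Pred (Fin n) ℓ) (C : Cycle G T) →
                (∀ {a b} → a ∈ T → b ∈ T → Adj G a b → P a → P b) →
                P (Cycle.f C zero) → ∀ i → P (Cycle.f C i)
    cycle-all P C closed P₀ = <-weakInduction (P ∘ f) P₀
      (λ i → closed (inT (inject₁ i)) (inT (suc i)) (edges i))
      where open Cycle C

    cycle-inside⊎outside : (C : Cycle G T) →
      (∀ {a b} → a ∈ T → b ∈ T → Adj G a b → a ∈ M → b ∈ M) →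
      (∀ i → Cycle.f C i ∈ M) ⊎ (∀ i → Cycle.f C i ∉ M)
    cycle-inside⊎outside {M = M} C closed with Cycle.f C zero ∈? M
    ... | yes f₀∈M = inj₁ (cycle-all (_∈ M) C closed f₀∈M)
    ... | no  f₀∉M = inj₂ (cycle-all (_∉ M) C
            (λ a∈T b∈T ab a∉M b∈M → a∉M (closed b∈T a∈T (Adj-sym ab) b∈M)) f₀∉M)

    cycle-neighbours : (C : Cycle G T) → ∀ j → let open Cycle C in
      ∃₂ λ i i′ → i ≢ i′ × Adj G (f j) (f i) × Adj G (f j) (f i′)
    cycle-neighbours C zero =
      suc zero , fromℕ (ℕ.suc (ℕ.suc k)) , (λ ()) , edges zero , Adj-sym close
      where open Cycle C
    cycle-neighbours C (suc j) with view j
    ... | ‵fromℕ = inject₁ (fromℕ (ℕ.suc k)) , zero , (λ ())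
                 , Adj-sym (edges (fromℕ (ℕ.suc k))) , close
      where open Cycle C
    ... | ‵inject₁ i = inject₁ (inject₁ i) , suc (suc i) , inject₁²≢suc² i
                     , Adj-sym (edges (inject₁ i)) , edges (suc i)
      where
      open Cycle C
      inject₁²≢suc² : ∀ {m} (i : Fin m) → inject₁ (inject₁ i) ≢ suc (suc i)
      inject₁²≢suc² zero ()
      inject₁²≢suc² (suc i) = inject₁²≢suc² i ∘ suc-injective

  cycle-avoids : (C : Cycle G (⊤ ─ X)) → ∀ i → Cycle.f C i ∉ X
  cycle-avoids {X = X} C i = x∈p─q⇒x∉q ⊤ X (Cycle.inT C i)

  TriangleFree : Subset n → Set
  TriangleFree T = ∀ {a b c} → a ∈ T → b ∈ T → c ∈ T →
    Adj G a b → Adj G b c → Adj G c a → ⊥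

  forest⇒triangleFree : ∀ {T} → IsForest G T → TriangleFree T
  forest⇒triangleFree forest a∈T b∈T c∈T ab bc ca = forest (triangle a∈T b∈T c∈T ab bc ca)

  bipartite⇒triangleFree : ∀ {T} → IsBipartite G T → TriangleFree T
  bipartite⇒triangleFree (_ , proper) a∈T b∈T c∈T ab bc ca =
    proper _ _ c∈T a∈T ca (trans (¬-not (≢-sym (proper _ _ b∈T c∈T bc)))
                                 (sym (¬-not (proper _ _ a∈T b∈T ab))))

  module _ {S : Subset n} where

    walk-start : Walk G S u v → u ∈ S
    walk-start (here u∈S)     = u∈S
    walk-start (step u∈S _ _) = u∈S

    _++ʷ_ : Walk G S u v → Walk G S v w → Walk G S u w
    here _         ++ʷ W′ = W′
    step u∈S uv W  ++ʷ W′ = step u∈S uv (W ++ʷ W′)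

    reverseʷ : Walk G S u v → Walk G S v u
    reverseʷ (here u∈S)     = here u∈S
    reverseʷ (step u∈S uw W) = reverseʷ W ++ʷ step (walk-start W) (Adj-sym uw) (here u∈S)

    walk-leaves : Walk G S u v → u ∈ M → v ∉ M → ∃₂ λ a b → a ∈ M × b ∉ M × Adj G a b
    walk-leaves (here _) u∈M u∉M = contradiction u∈M u∉M
    walk-leaves {M = M} (step {w = w} _ uw W) u∈M v∉M with w ∈? M
    ... | yes w∈M = walk-leaves W w∈M v∉M
    ... | no  w∉M = _ , w , u∈M , w∉M , uw

  -- Modules

  module _ (M : Subset n) (isModule : IsModule G M) where

    Neighbour : Fin n → Set
    Neighbour u = u ∉ M × (∀ w → w ∈ M → Adj G u w)

    Neighbour? : Decidable Neighbour
    Neighbour? u = ¬? (u ∈? M) ×-dec all? (λ w → w ∈? M →-dec Adj? u w)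

    neighbour-of-edge : u ∉ M → w ∈ M → Adj G u w → Neighbour u
    neighbour-of-edge {u} {w} u∉M w∈M uw =
      u∉M , [ id , (λ none → contradiction uw (none w w∈M)) ] (isModule u u∉M)

    neighbour-exists : Connected G → Nonempty M → M ≢ ⊤ → ∃ Neighbour
    neighbour-exists connected (m , m∈M) M≢⊤
      with ¬∀⟶∃¬ _ (_∈ M) (_∈? M) (λ M-all → M≢⊤ (⊆-antisym ⊆⊤ (λ {x} _ → M-all x)))
    ... | w , w∉M with walk-leaves (connected m w ∈⊤ ∈⊤) m∈M w∉M
    ...   | a , b , a∈M , b∉M , ab = b , neighbour-of-edge b∉M a∈M (Adj-sym ab)

    crossing-in-patch : (∀ u → Neighbour u → u ∈ X) → u ∉ M → w ∈ M → Adj G u w →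
                        u ∈ patch M X Y
    crossing-in-patch N⊆X u∉M w∈M uw =
      ∈-patch-outside u∉M (N⊆X _ (neighbour-of-edge u∉M w∈M uw))

    VC-restrict : IsVC G ⊤ X → IsVC G M (M ∩ X)
    VC-restrict {X = X} (_ , cover) = p∩q⊆p M X , λ a b a∈M b∈M ab →
      Sum.map (x∈p∩q⁺ ∘ (a∈M ,_)) (x∈p∩q⁺ ∘ (b∈M ,_)) (cover a b ∈⊤ ∈⊤ ab)

    VC-covers-module : IsVC G ⊤ X → Neighbour u → u ∉ X → M ⊆ X
    VC-covers-module (_ , cover) (_ , u-adj) u∉X {v} v∈M =
      [ (λ u∈X → contradiction u∈X u∉X) , id ] (cover _ v ∈⊤ ∈⊤ (u-adj v v∈M))

    VC-patch : IsVC G ⊤ X → (∀ u → Neighbour u → u ∈ X) → IsVC G M Y →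
               IsVC G ⊤ (patch M X Y)
    VC-patch {X = X} {Y = Y} (_ , coverX) N⊆X (_ , coverY) = ⊆⊤ , cover
      where
      cover : ∀ a b → a ∈ ⊤ → b ∈ ⊤ → Adj G a b → a ∈ patch M X Y ⊎ b ∈ patch M X Y
      cover a b _ _ ab with a ∈? M | b ∈? M
      ... | yes a∈M | yes b∈M =
        Sum.map (∈-patch-inside a∈M) (∈-patch-inside b∈M) (coverY a b a∈M b∈M ab)
      ... | no a∉M | no b∉M =
        Sum.map (∈-patch-outside a∉M) (∈-patch-outside b∉M) (coverX a b ∈⊤ ∈⊤ ab)
      ... | yes a∈M | no b∉M = inj₂ (crossing-in-patch N⊆X b∉M a∈M (Adj-sym ab))
      ... | no a∉M | yes b∈M = inj₁ (crossing-in-patch N⊆X a∉M b∈M ab)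

    minVC-on-module : IsMinimum (IsVC G ⊤) C → M ∩ C ≡ M ⊎ IsMinimum (IsVC G M) (M ∩ C)
    minVC-on-module {C = C} minC@(vcC , _) with ∀⊎∃¬ Neighbour? (_∈? C)
    ... | inj₂ (u , u-nbr , u∉C) = inj₁ (p⊆q⇒p∩q≡p (VC-covers-module vcC u-nbr u∉C))
    ... | inj₁ N⊆C = inj₂ (VC-restrict vcC , λ Y vcY → patch-minimal minC (VC-patch vcC N⊆C vcY))

    triangleFree⇒VC : TriangleFree (⊤ ─ X) → Neighbour u → u ∉ X → IsVC G M (M ∩ X)
    triangleFree⇒VC {X = X} noTriangle (_ , u-adj) u∉X = p∩q⊆p M X , cover
      where
      cover : ∀ a b → a ∈ M → b ∈ M → Adj G a b → a ∈ M ∩ X ⊎ b ∈ M ∩ X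
      cover a b a∈M b∈M ab with a ∈? X | b ∈? X
      ... | yes a∈X | _       = inj₁ (x∈p∩q⁺ (a∈M , a∈X))
      ... | no _    | yes b∈X = inj₂ (x∈p∩q⁺ (b∈M , b∈X))
      ... | no a∉X  | no b∉X  = ⊥-elim (noTriangle
        (x∉p⇒x∈⊤─p a∉X) (x∉p⇒x∈⊤─p b∉X) (x∉p⇒x∈⊤─p u∉X) ab (Adj-sym (u-adj b b∈M)) (u-adj a a∈M))

    FVS-restrict : IsFVS G ⊤ F → IsFVS G M (M ∩ F)
    FVS-restrict {F = F} (_ , forest) =
      p∩q⊆p M F , λ C → forest (cycle-within C (p─p∩q⊆⊤─q M F ∘ Cycle.inT C))

    FVS-patch-FVS : IsFVS G ⊤ F → (∀ u → Neighbour u → u ∈ F) → IsFVS G M Y →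
                    IsFVS G ⊤ (patch M F Y)
    FVS-patch-FVS {F = F} {Y = Y} (_ , forestF) N⊆F (_ , forestY) = ⊆⊤ , no-cycle
      where
      M-closed : a ∈ ⊤ ─ patch M F Y → b ∈ ⊤ ─ patch M F Y → Adj G a b → a ∈ M → b ∈ M
      M-closed {b = b} _ b∉P ab a∈M = decidable-stable (b ∈? M) λ b∉M →
        x∈p─q⇒x∉q ⊤ (patch M F Y) b∉P (crossing-in-patch N⊆F b∉M a∈M (Adj-sym ab))
      no-cycle : IsForest G (⊤ ─ patch M F Y)
      no-cycle C with cycle-inside⊎outside C M-closed
      ... | inj₁ inside  = forestY (cycle-within C λ i → ⊤─patch-inside (inside i) (Cycle.inT C i))
      ... | inj₂ outside =
        forestF (cycle-within C λ i → ⊤─patch-outside (outside i) (Cycle.inT C i))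

    FVS-patch-VC : IsFVS G ⊤ F → (∀ v → Neighbour v × v ∉ F → v ≡ u) → IsVC G M Y →
                   IsFVS G ⊤ (patch M F Y)
    FVS-patch-VC {F = F} {u = u} {Y = Y} (_ , forestF) unique (_ , coverY) = ⊆⊤ , no-cycle
      where
      no-cycle : IsForest G (⊤ ─ patch M F Y)
      no-cycle C with any? (λ j → Cycle.f C j ∈? M)
      ... | no ∄ = forestF (cycle-within C λ i → ⊤─patch-outside (∄ ∘ (i ,_)) (Cycle.inT C i))
      ... | yes (j , fj∈M) with cycle-neighbours C j
      ...   | i , i′ , i≢i′ , ji , ji′ = i≢i′ (inj (trans (is-u ji) (sym (is-u ji′))))
        where
        open Cycle C
        is-u : ∀ {i} → Adj G (f j) (f i) → f i ≡ u
        is-u {i} ji with f i ∈? M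
        ... | yes fi∈M = ⊥-elim ([ cycle-avoids C j ∘ ∈-patch-inside fj∈M
                                 , cycle-avoids C i ∘ ∈-patch-inside fi∈M ]
                                 (coverY _ _ fj∈M fi∈M ji))
        ... | no fi∉M = unique (f i) ( neighbour-of-edge fi∉M fj∈M (Adj-sym ji)
                                     , cycle-avoids C i ∘ ∈-patch-outside fi∉M)

    FVS-two-neighbours : IsFVS G ⊤ F → ∀ {u u′} → Neighbour u → Neighbour u′ → u ≢ u′ →
                         u ∉ F → u′ ∉ F → v ∈ M → v ∉ F → M ∩ F ≡ M - v
    FVS-two-neighbours {F = F} {v = v} (_ , forest) {u} {u′} (_ , u-adj) (_ , u′-adj) u≢u′
                       u∉F u′∉F v∈M v∉F = ⊆-antisym M∩F⊆M-v M-v⊆M∩F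
      where
      M∩F⊆M-v : M ∩ F ⊆ M - v
      M∩F⊆M-v x∈M∩F with x∈p∩q⁻ M F x∈M∩F
      ... | x∈M , x∈F = x∈p∧x≢y⇒x∈p-y x∈M λ { refl → v∉F x∈F }
      M-v⊆M∩F : M - v ⊆ M ∩ F
      M-v⊆M∩F {x} x∈M-v = x∈p∩q⁺ (x∈M , decidable-stable (x ∈? F) λ x∉F → forest
        (square v≢x u≢u′ (x∉p⇒x∈⊤─p v∉F) (x∉p⇒x∈⊤─p u∉F) (x∉p⇒x∈⊤─p x∉F) (x∉p⇒x∈⊤─p u′∉F)
                (Adj-sym (u-adj v v∈M)) (u-adj x x∈M) (Adj-sym (u′-adj x x∈M)) (u′-adj v v∈M)))
        where
        x∈M = p─q⊆p M ⁅ v ⁆ x∈M-v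
        v≢x = ≢-sym (x∉⁅y⁆⇒x≢y (x∈p─q⇒x∉q M ⁅ v ⁆ x∈M-v))

    minFVS-on-module : IsMinimum (IsFVS G ⊤) F →
      M ∩ F ≡ M ⊎ (∃ λ v → v ∈ M × M ∩ F ≡ M - v)
        ⊎ IsMinimum (IsVC G M) (M ∩ F) ⊎ IsMinimum (IsFVS G M) (M ∩ F)
    minFVS-on-module {F = F} minF@(fvsF , _) with ∀⊎∃¬ Neighbour? (_∈? F)
    ... | inj₁ N⊆F = inj₂ (inj₂ (inj₂
          (FVS-restrict fvsF , λ Y fvsY → patch-minimal minF (FVS-patch-FVS fvsF N⊆F fvsY))))
    ... | inj₂ (u , u-nbr , u∉F) with ∀⊎∃¬ (λ v → Neighbour? v ×-dec ¬? (v ∈? F)) (_≟ u)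
    ...   | inj₁ unique = inj₂ (inj₂ (inj₁
            ( triangleFree⇒VC (forest⇒triangleFree (proj₂ fvsF)) u-nbr u∉F
            , λ Y vcY → patch-minimal minF (FVS-patch-VC fvsF unique vcY))))
    ...   | inj₂ (u′ , (u′-nbr , u′∉F) , u′≢u) with ⊆⊎∃∉ M F
    ...     | inj₁ M⊆F = inj₁ (p⊆q⇒p∩q≡p M⊆F)
    ...     | inj₂ (v , v∈M , v∉F) =
              inj₂ (inj₁ (v , v∈M ,
                FVS-two-neighbours fvsF u-nbr u′-nbr (≢-sym u′≢u) u∉F u′∉F v∈M v∉F))

    glue : ∀ {A : Set} → (Fin n → A) → (Fin n → A) → Fin n → A
    glue inside outside v with v ∈? M
    ... | yes _ = inside v
    ... | no  _ = outside v

    OCT-restrict : IsOCT G ⊤ O → IsOCT G M (M ∩ O)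
    OCT-restrict {O = O} (_ , colour , proper) = p∩q⊆p M O , colour ,
      λ a b a∈ b∈ → proper a b (p─p∩q⊆⊤─q M O a∈) (p─p∩q⊆⊤─q M O b∈)

    OCT-patch-OCT : IsOCT G ⊤ O → (∀ u → Neighbour u → u ∈ O) → IsOCT G M Y →
                    IsOCT G ⊤ (patch M O Y)
    OCT-patch-OCT {O = O} {Y = Y} (_ , colour , proper) N⊆O (_ , colourY , properY) =
      ⊆⊤ , glue colourY colour , proper′
      where
      proper′ : ∀ a b → a ∈ ⊤ ─ patch M O Y → b ∈ ⊤ ─ patch M O Y → Adj G a b →
                glue colourY colour a ≢ glue colourY colour b
      proper′ a b a∉P b∉P ab with a ∈? M | b ∈? M
      ... | yes a∈M | yes b∈M = properY a b (⊤─patch-inside a∈M a∉P) (⊤─patch-inside b∈M b∉P) ab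
      ... | no a∉M  | no b∉M  = proper a b (⊤─patch-outside a∉M a∉P) (⊤─patch-outside b∉M b∉P) ab
      ... | yes a∈M | no b∉M  =
        ⊥-elim (x∈p─q⇒x∉q ⊤ _ b∉P (crossing-in-patch N⊆O b∉M a∈M (Adj-sym ab)))
      ... | no a∉M  | yes b∈M = ⊥-elim (x∈p─q⇒x∉q ⊤ _ a∉P (crossing-in-patch N⊆O a∉M b∈M ab))

    -- Colour all of M with the colour of v: a vertex outside O adjacent to M is adjacent to v.
    OCT-patch-VC : IsOCT G ⊤ O → v ∈ M → v ∉ O → IsVC G M Y → IsOCT G ⊤ (patch M O Y)
    OCT-patch-VC {O = O} {v = v} {Y = Y} (_ , colour , proper) v∈M v∉O (_ , coverY) =
      ⊆⊤ , glue (λ _ → colour v) colour , proper′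
      where
      v∉O′ = x∉p⇒x∈⊤─p v∉O
      proper′ : ∀ a b → a ∈ ⊤ ─ patch M O Y → b ∈ ⊤ ─ patch M O Y → Adj G a b →
                glue (λ _ → colour v) colour a ≢ glue (λ _ → colour v) colour b
      proper′ a b a∉P b∉P ab with a ∈? M | b ∈? M
      ... | yes a∈M | yes b∈M = ⊥-elim ([ x∈p─q⇒x∉q M Y (⊤─patch-inside a∈M a∉P)
                                         , x∈p─q⇒x∉q M Y (⊤─patch-inside b∈M b∉P) ]
                                         (coverY a b a∈M b∈M ab))
      ... | no a∉M  | no b∉M  = proper a b (⊤─patch-outside a∉M a∉P) (⊤─patch-outside b∉M b∉P) ab
      ... | yes a∈M | no b∉M  = proper v b v∉O′ (⊤─patch-outside b∉M b∉P)
        (Adj-sym (proj₂ (neighbour-of-edge b∉M a∈M (Adj-sym ab)) v v∈M))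
      ... | no a∉M  | yes b∈M = proper a v (⊤─patch-outside a∉M a∉P) v∉O′
        (proj₂ (neighbour-of-edge a∉M b∈M ab) v v∈M)

    minOCT-on-module : IsMinimum (IsOCT G ⊤) O →
      M ∩ O ≡ M ⊎ IsMinimum (IsVC G M) (M ∩ O) ⊎ IsMinimum (IsOCT G M) (M ∩ O)
    minOCT-on-module {O = O} minO@(octO , _) with ∀⊎∃¬ Neighbour? (_∈? O)
    ... | inj₁ N⊆O = inj₂ (inj₂
          (OCT-restrict octO , λ Y octY → patch-minimal minO (OCT-patch-OCT octO N⊆O octY)))
    ... | inj₂ (u , u-nbr , u∉O) with ⊆⊎∃∉ M O
    ...   | inj₁ M⊆O = inj₁ (p⊆q⇒p∩q≡p M⊆O)
    ...   | inj₂ (v , v∈M , v∉O) = inj₂ (inj₁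
            ( triangleFree⇒VC (bipartite⇒triangleFree (proj₂ octO)) u-nbr u∉O
            , λ Y vcY → patch-minimal minO (OCT-patch-VC octO v∈M v∉O vcY)))

    CVC-patch : IsCVC G ⊤ R → (∀ u → Neighbour u → u ∈ R) → Neighbour w →
                IsVC G M Y → Nonempty Y → IsCVC G ⊤ (patch M R Y)
    CVC-patch {R = R} {w = w} {Y = Y} (vcR , connR) N⊆R w-nbr@(w∉M , w-adj)
              vcY@(Y⊆M , _) (y , y∈Y) =
      VC-patch vcR N⊆R vcY , λ a b a∈P b∈P → to-w a∈P ++ʷ reverseʷ (to-w b∈P)
      where
      P = patch M R Y
      w∈P : w ∈ P
      w∈P = ∈-patch-outside w∉M (N⊆R w w-nbr)
      y∈M = Y⊆M y∈Y
      -- An R-walk to w stays in P until it is about to enter M; there it jumps to w through y.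
      reroute : Walk G R a w → a ∉ M → Walk G P a w
      reroute (here a∈R) a∉M = here (∈-patch-outside a∉M a∈R)
      reroute (step {w = b} a∈R ab W) a∉M with b ∈? M
      ... | yes b∈M = step (∈-patch-outside a∉M a∈R) (proj₂ (neighbour-of-edge a∉M b∈M ab) y y∈M)
                        (step (∈-patch-inside y∈M y∈Y) (Adj-sym (w-adj y y∈M)) (here w∈P))
      ... | no b∉M  = step (∈-patch-outside a∉M a∈R) ab (reroute W b∉M)
      to-w : a ∈ P → Walk G P a w
      to-w {a} a∈P with a ∈? M
      ... | yes a∈M = step a∈P (Adj-sym (w-adj a a∈M)) (here w∈P)
      ... | no a∉M  = reroute (connR a w (∈-patch-outside⁻ a∉M a∈P) (N⊆R w w-nbr)) a∉M

    minCVC-on-module : Neighbour w → IsMinimum (IsCVC G ⊤) R →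
      M ∩ R ≡ M ⊎ IsMinimum (IsVC G M) (M ∩ R) ⊎ (∃ λ v → v ∈ M × M ∩ R ≡ ⁅ v ⁆)
    minCVC-on-module {R = R} w-nbr minR@(cvcR@(vcR , _) , _) with ∀⊎∃¬ Neighbour? (_∈? R)
    ... | inj₂ (u , u-nbr , u∉R) = inj₁ (p⊆q⇒p∩q≡p (VC-covers-module vcR u-nbr u∉R))
    ... | inj₁ N⊆R with nonempty? (M ∩ R)
    ...   | no M∩R-empty =
            inj₂ (inj₁ (VC-restrict vcR , λ Y _ → subst (_≤ ∣ Y ∣) (sym ∣M∩R∣≡0) z≤n))
      where
      ∣M∩R∣≡0 : ∣ M ∩ R ∣ ≡ 0
      ∣M∩R∣≡0 = trans (cong ∣_∣ (Empty-unique M∩R-empty)) (∣⊥∣≡0 n)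
    ...   | yes (v , v∈M∩R) with any? (λ a → any? λ b → a ∈? M ×-dec b ∈? M ×-dec Adj? a b)
    ...     | yes (a , b , a∈M , b∈M , ab) = inj₂ (inj₁ (VC-restrict vcR , λ Y vcY →
              patch-minimal minR (CVC-patch cvcR N⊆R w-nbr vcY
                ([ (a ,_) , (b ,_) ]′ (proj₂ vcY a b a∈M b∈M ab)))))
    ...     | no edgeless = inj₂ (inj₂ (v , proj₁ (x∈p∩q⁻ M R v∈M∩R) ,
              x∈p∧∣p∣≤1⇒p≡⁅x⁆ v∈M∩R (subst (∣ M ∩ R ∣ ≤_) (∣⁅x⁆∣≡1 v)
                (patch-minimal minR (CVC-patch cvcR N⊆R w-nbr vc⁅v⁆ (v , x∈⁅x⁆ v))))))
      where
      vc⁅v⁆ : IsVC G M ⁅ v ⁆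
      vc⁅v⁆ = (λ x∈⁅v⁆ → subst (_∈ M) (sym (x∈⁅y⁆⇒x≡y v x∈⁅v⁆)) (proj₁ (x∈p∩q⁻ M R v∈M∩R)))
            , λ a b a∈M b∈M ab → ⊥-elim (edgeless (a , b , a∈M , b∈M , ab))

lemma8 : ∀ {n} (G : Graph n) → Connected G →
    ∀ (M C F O R : Subset n) → IsModule G M → Nonempty M → M ≢ ⊤ →
    IsMinimum (IsVC G ⊤) C → IsMinimum (IsFVS G ⊤) F →
    IsMinimum (IsOCT G ⊤) O → IsMinimum (IsCVC G ⊤) R →
    (M ∩ C ≡ M ⊎ IsMinimum (IsVC G M) (M ∩ C))
    × (M ∩ F ≡ M ⊎ (∃ λ v → v ∈ M × M ∩ F ≡ M - v)
        ⊎ IsMinimum (IsVC G M) (M ∩ F) ⊎ IsMinimum (IsFVS G M) (M ∩ F))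
    × (M ∩ O ≡ M ⊎ IsMinimum (IsVC G M) (M ∩ O) ⊎ IsMinimum (IsOCT G M) (M ∩ O))
    × (M ∩ R ≡ M ⊎ IsMinimum (IsVC G M) (M ∩ R) ⊎ (∃ λ v → v ∈ M × M ∩ R ≡ ⁅ v ⁆))
lemma8 G connected M C F O R isModule M≢∅ M≢⊤ minC minF minO minR =
    minVC-on-module  G M isModule minC
  , minFVS-on-module G M isModule minF
  , minOCT-on-module G M isModule minO
  , minCVC-on-module G M isModule w-nbr minR
  where
  w-nbr = proj₂ (neighbour-exists G M isModule connected M≢∅ M≢⊤)
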